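{- Let $\mathbf{A}=\langle A,\vee,\wedge,\ast,\to,\forall,\exists,0,1\rangle$ be an Epistemic BL-algebra. Then $\forall A=\exists A$, where $\forall A=\{\forall a:a\in A\}$ and $\exists A=\{\exists a:a\in A\}$. Moreover, $\exists A$ is closed under the operations $\vee,\wedge,\ast,\to,0,1$ of $\mathbf{A}$, so it is a BL-subalgebra of $\mathbf{A}$.
   Context: A BL-algebra is an algebra $\langle A,\wedge,\vee,\ast,\to,0,1\rangle$ such that $\langle A,\wedge,\vee,0,1\rangle$ is a bounded lattice (with order $\le$), $\langle A,\ast,1\rangle$ is a commutative monoid, $a\ast b\le c$ iff $a\le b\to c$ for all $a,b,c$, and the identities $a\wedge b=a\ast(a\to b)$ and $(a\to b)\vee(b\to a)=1$ hold. An Epistemic BL-algebra (EBL-algebra) is an algebra $\langle A,\vee,\wedge,\ast,\to,\forall,\exists,0,1\rangle$ whose reduct $\langle A,\vee,\wedge,\ast,\to,0,1\rangle$ is a BL-algebra and where $\forall,\exists$ are unary operations satisfying, for all $a,b$: (E$\forall$) $\forall 1=1$; (E$\exists$) $\exists 0=0$; (E1) $\forall a\to\exists a=1$; (E2) $\forall(a\to\forall b)=\exists a\to\forall b$; (E3) $\forall(\forall a\to b)=\forall a\to\forall b$; (E4) $\exists a\to\forall\exists a=1$; (E4a) $\forall(a\wedge b)=\forall a\wedge\forall b$; (E4b) $\exists(a\vee b)=\exists a\vee\exists b$; (E5) $\exists(a\ast\exists b)=\exists a\ast\exists b$. -}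

module Defs where

open import Level using (Level; suc; _⊔_)
open import Relation.Binary.PropositionalEquality using (_≡_)
open import Data.Product using (Σ; ∃; _×_; _,_)

record EBLAlgebra (ℓ : Level) : Set (suc ℓ) where
  infixr 6 _∨_
  infixr 7 _∧_
  infixr 7 _*_
  infixr 5 _⇒_
  infix 4 _≤_
  field
    Carrier : Set ℓ
    _∨_ _∧_ _*_ _⇒_ : Carrier → Carrier → Carrier
    ∀' ∃' : Carrier → Carrier
    𝟘 𝟙 : Carrier

  _≤_ : Carrier → Carrier → Set ℓ
  a ≤ b = a ∧ b ≡ a

  field
    ∨-comm   : ∀ a b → a ∨ b ≡ b ∨ a
    ∧-comm   : ∀ a b → a ∧ b ≡ b ∧ a
    ∨-assoc  : ∀ a b c → (a ∨ b) ∨ c ≡ a ∨ (b ∨ c)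
    ∧-assoc  : ∀ a b c → (a ∧ b) ∧ c ≡ a ∧ (b ∧ c)
    ∨-absorbs-∧ : ∀ a b → a ∨ (a ∧ b) ≡ a
    ∧-absorbs-∨ : ∀ a b → a ∧ (a ∨ b) ≡ a
    𝟘-least  : ∀ a → 𝟘 ≤ a
    𝟙-greatest : ∀ a → a ≤ 𝟙
    *-comm   : ∀ a b → a * b ≡ b * a
    *-assoc  : ∀ a b c → (a * b) * c ≡ a * (b * c)
    *-identityʳ : ∀ a → a * 𝟙 ≡ a
    residuation₁ : ∀ a b c → a * b ≤ c → a ≤ (b ⇒ c)
    residuation₂ : ∀ a b c → a ≤ (b ⇒ c) → a * b ≤ c
    divisibility : ∀ a b → a ∧ b ≡ a * (a ⇒ b)
    prelinearity : ∀ a b → (a ⇒ b) ∨ (b ⇒ a) ≡ 𝟙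
    E∀  : ∀' 𝟙 ≡ 𝟙
    E∃  : ∃' 𝟘 ≡ 𝟘
    E1  : ∀ a → ∀' a ⇒ ∃' a ≡ 𝟙
    E2  : ∀ a b → ∀' (a ⇒ ∀' b) ≡ ∃' a ⇒ ∀' b
    E3  : ∀ a b → ∀' (∀' a ⇒ b) ≡ ∀' a ⇒ ∀' b
    E4  : ∀ a → ∃' a ⇒ ∀' (∃' a) ≡ 𝟙
    E4a : ∀ a b → ∀' (a ∧ b) ≡ ∀' a ∧ ∀' b
    E4b : ∀ a b → ∃' (a ∨ b) ≡ ∃' a ∨ ∃' b
    E5  : ∀ a b → ∃' (a * ∃' b) ≡ ∃' a * ∃' b

  In∀A : Carrier → Set ℓ
  In∀A x = ∃ λ a → x ≡ ∀' a

  In∃A : Carrier → Set ℓ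
  In∃A x = ∃ λ a → x ≡ ∃' a

-- Both ∀ and ∃ restrict to the identity on each other's image: ∃ ∀ a = ∀ a follows
-- from E1–E3, and ∀ ∃ a = ∃ a from E4 and E5, since ∃ a ≤ ∀ ∃ a lets us write
-- ∃ a = (∀ ∃ a ⇒ ∃ a) * ∀ ∃ a and ∃ sends the first factor to 𝟙.  Hence ∀A and ∃A
-- are both the set of common fixed points of ∀ and ∃, on which E4b, E4a, E5 and E2
-- say that ∨, ∧, * and ⇒ are preserved.
module Submission where

open import Defs
open import Level using (Level)
open import Data.Product using (_×_; _,_)
open import Relation.Binary.PropositionalEquality

module EBLProperties {ℓ : Level} (A : EBLAlgebra ℓ) where
  open EBLAlgebra A
  open ≡-Reasoning

  ∧-idem : ∀ x → x ∧ x ≡ x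
  ∧-idem x = trans (cong (x ∧_) (sym (∨-absorbs-∧ x x))) (∧-absorbs-∨ x (x ∧ x))

  ≤-antisym : ∀ {x y} → x ≤ y → y ≤ x → x ≡ y
  ≤-antisym {x} {y} x≤y y≤x = trans (sym x≤y) (trans (∧-comm x y) y≤x)

  ≤-trans : ∀ {x y z} → x ≤ y → y ≤ z → x ≤ z
  ≤-trans {x} {y} {z} x≤y y≤z = begin
    x ∧ z        ≡⟨ cong (_∧ z) (sym x≤y) ⟩
    (x ∧ y) ∧ z  ≡⟨ ∧-assoc x y z ⟩
    x ∧ (y ∧ z)  ≡⟨ cong (x ∧_) y≤z ⟩
    x ∧ y        ≡⟨ x≤y ⟩
    x            ∎

  𝟙≤⇒≡𝟙 : ∀ {x} → 𝟙 ≤ x → x ≡ 𝟙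
  𝟙≤⇒≡𝟙 {x} = ≤-antisym (𝟙-greatest x)

  *-identityˡ : ∀ x → 𝟙 * x ≡ x
  *-identityˡ x = trans (*-comm 𝟙 x) (*-identityʳ x)

  ⇒-refl : ∀ x → x ⇒ x ≡ 𝟙
  ⇒-refl x = 𝟙≤⇒≡𝟙 (residuation₁ 𝟙 x x 𝟙*x≤x)
    where
    𝟙*x≤x : 𝟙 * x ≤ x
    𝟙*x≤x = trans (cong (_∧ x) (*-identityˡ x)) (trans (∧-idem x) (sym (*-identityˡ x)))

  ⇒≡𝟙⇒≤ : ∀ {x y} → x ⇒ y ≡ 𝟙 → x ≤ y
  ⇒≡𝟙⇒≤ {x} {y} x⇒y≡𝟙 = subst (_≤ y) (*-identityˡ x) (residuation₂ 𝟙 x y 𝟙≤x⇒y)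
    where
    𝟙≤x⇒y : 𝟙 ≤ x ⇒ y
    𝟙≤x⇒y = subst (λ w → 𝟙 ∧ w ≡ 𝟙) (sym x⇒y≡𝟙) (∧-idem 𝟙)

  ≤⇒≡⇒-* : ∀ {x y} → x ≤ y → x ≡ (y ⇒ x) * y
  ≤⇒≡⇒-* {x} {y} x≤y = begin
    x            ≡⟨ sym x≤y ⟩
    x ∧ y        ≡⟨ ∧-comm x y ⟩
    y ∧ x        ≡⟨ divisibility y x ⟩
    y * (y ⇒ x)  ≡⟨ *-comm y (y ⇒ x) ⟩
    (y ⇒ x) * y  ∎

  ∀≤∃ : ∀ a → ∀' a ≤ ∃' a
  ∀≤∃ a = ⇒≡𝟙⇒≤ (E1 a)

  ∀≡𝟙⇒∃≡𝟙 : ∀ {a} → ∀' a ≡ 𝟙 → ∃' a ≡ 𝟙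
  ∀≡𝟙⇒∃≡𝟙 {a} ∀a≡𝟙 = 𝟙≤⇒≡𝟙 (subst (_≤ ∃' a) ∀a≡𝟙 (∀≤∃ a))

  ∀-∀⇒∀≡𝟙 : ∀ a → ∀' (∀' a ⇒ ∀' a) ≡ 𝟙
  ∀-∀⇒∀≡𝟙 a = trans (cong ∀' (⇒-refl (∀' a))) E∀

  ∃𝟙≡𝟙 : ∃' 𝟙 ≡ 𝟙
  ∃𝟙≡𝟙 = ∀≡𝟙⇒∃≡𝟙 E∀

  ∃∀≡∀ : ∀ a → ∃' (∀' a) ≡ ∀' a
  ∃∀≡∀ a = ≤-antisym ∃∀≤∀ (≤-trans ∀≤∀∀ (∀≤∃ (∀' a)))
    where
    ∀≤∀∀ : ∀' a ≤ ∀' (∀' a)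
    ∀≤∀∀ = ⇒≡𝟙⇒≤ (trans (sym (E3 a (∀' a))) (∀-∀⇒∀≡𝟙 a))
    ∃∀≤∀ : ∃' (∀' a) ≤ ∀' a
    ∃∀≤∀ = ⇒≡𝟙⇒≤ (trans (sym (E2 (∀' a) a)) (∀-∀⇒∀≡𝟙 a))

  ∃∃≡∃ : ∀ a → ∃' (∃' a) ≡ ∃' a
  ∃∃≡∃ a = begin
    ∃' (∃' a)        ≡⟨ cong ∃' (sym (*-identityˡ (∃' a))) ⟩
    ∃' (𝟙 * ∃' a)    ≡⟨ E5 𝟙 a ⟩
    ∃' 𝟙 * ∃' a      ≡⟨ cong (_* ∃' a) ∃𝟙≡𝟙 ⟩
    𝟙 * ∃' a         ≡⟨ *-identityˡ (∃' a) ⟩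
    ∃' a             ∎

  ∃-∀⇒≡𝟙 : ∀ a → ∃' (∀' a ⇒ a) ≡ 𝟙
  ∃-∀⇒≡𝟙 a = ∀≡𝟙⇒∃≡𝟙 (trans (E3 a a) (⇒-refl (∀' a)))

  ∀∃≡∃ : ∀ a → ∀' (∃' a) ≡ ∃' a
  ∀∃≡∃ a = sym (begin
    c                  ≡⟨ sym (∃∃≡∃ a) ⟩
    ∃' c               ≡⟨ cong ∃' (≤⇒≡⇒-* (⇒≡𝟙⇒≤ (E4 a))) ⟩
    ∃' ((d ⇒ c) * d)   ≡⟨ cong (λ w → ∃' ((d ⇒ c) * w)) (sym (∃∀≡∀ c)) ⟩
    ∃' ((d ⇒ c) * ∃' d) ≡⟨ E5 (d ⇒ c) d ⟩
    ∃' (d ⇒ c) * ∃' d  ≡⟨ cong₂ _*_ (∃-∀⇒≡𝟙 c) (∃∀≡∀ c) ⟩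
    𝟙 * d              ≡⟨ *-identityˡ d ⟩
    d                  ∎)
    where
    c = ∃' a
    d = ∀' c

  In∃A⇒∃-fixed : ∀ {x} → In∃A x → ∃' x ≡ x
  In∃A⇒∃-fixed (a , refl) = ∃∃≡∃ a

  In∃A⇒∀-fixed : ∀ {x} → In∃A x → ∀' x ≡ x
  In∃A⇒∀-fixed (a , refl) = ∀∃≡∃ a

  ∃-fixed⇒In∃A : ∀ {x} → ∃' x ≡ x → In∃A x
  ∃-fixed⇒In∃A {x} ∃x≡x = x , sym ∃x≡x

  ∀-fixed⇒In∃A : ∀ {x} → ∀' x ≡ x → In∃A x
  ∀-fixed⇒In∃A {x} ∀x≡x = ∃-fixed⇒In∃A (begin
    ∃' x       ≡⟨ cong ∃' (sym ∀x≡x) ⟩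
    ∃' (∀' x)  ≡⟨ ∃∀≡∀ x ⟩
    ∀' x       ≡⟨ ∀x≡x ⟩
    x          ∎)

  In∀A⇒In∃A : ∀ x → In∀A x → In∃A x
  In∀A⇒In∃A x (a , refl) = ∃-fixed⇒In∃A (∃∀≡∀ a)

  In∃A⇒In∀A : ∀ x → In∃A x → In∀A x
  In∃A⇒In∀A x x∈∃A = x , sym (In∃A⇒∀-fixed x∈∃A)

  In∃A-∨ : ∀ x y → In∃A x → In∃A y → In∃A (x ∨ y)
  In∃A-∨ x y x∈ y∈ = ∃-fixed⇒In∃A (begin
    ∃' (x ∨ y)     ≡⟨ E4b x y ⟩
    ∃' x ∨ ∃' y    ≡⟨ cong₂ _∨_ (In∃A⇒∃-fixed x∈) (In∃A⇒∃-fixed y∈) ⟩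
    x ∨ y          ∎)

  In∃A-∧ : ∀ x y → In∃A x → In∃A y → In∃A (x ∧ y)
  In∃A-∧ x y x∈ y∈ = ∀-fixed⇒In∃A (begin
    ∀' (x ∧ y)     ≡⟨ E4a x y ⟩
    ∀' x ∧ ∀' y    ≡⟨ cong₂ _∧_ (In∃A⇒∀-fixed x∈) (In∃A⇒∀-fixed y∈) ⟩
    x ∧ y          ∎)

  In∃A-* : ∀ x y → In∃A x → In∃A y → In∃A (x * y)
  In∃A-* x y x∈ y∈ = ∃-fixed⇒In∃A (begin
    ∃' (x * y)     ≡⟨ cong (λ w → ∃' (x * w)) (sym (In∃A⇒∃-fixed y∈)) ⟩
    ∃' (x * ∃' y)  ≡⟨ E5 x y ⟩
    ∃' x * ∃' y    ≡⟨ cong₂ _*_ (In∃A⇒∃-fixed x∈) (In∃A⇒∃-fixed y∈) ⟩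
    x * y          ∎)

  In∃A-⇒ : ∀ x y → In∃A x → In∃A y → In∃A (x ⇒ y)
  In∃A-⇒ x y x∈ y∈ = ∀-fixed⇒In∃A (begin
    ∀' (x ⇒ y)     ≡⟨ cong (λ w → ∀' (x ⇒ w)) (sym (In∃A⇒∀-fixed y∈)) ⟩
    ∀' (x ⇒ ∀' y)  ≡⟨ E2 x y ⟩
    ∃' x ⇒ ∀' y    ≡⟨ cong₂ _⇒_ (In∃A⇒∃-fixed x∈) (In∃A⇒∀-fixed y∈) ⟩
    x ⇒ y          ∎)

  In∃A-𝟘 : In∃A 𝟘
  In∃A-𝟘 = ∃-fixed⇒In∃A E∃

  In∃A-𝟙 : In∃A 𝟙
  In∃A-𝟙 = ∃-fixed⇒In∃A ∃𝟙≡𝟙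

theorem1 : {ℓ : Level} (A : EBLAlgebra ℓ) →
    let open EBLAlgebra A in
    ((∀ x → In∀A x → In∃A x) × (∀ x → In∃A x → In∀A x))
    × (∀ x y → In∃A x → In∃A y → In∃A (x ∨ y))
    × (∀ x y → In∃A x → In∃A y → In∃A (x ∧ y))
    × (∀ x y → In∃A x → In∃A y → In∃A (x * y))
    × (∀ x y → In∃A x → In∃A y → In∃A (x ⇒ y))
    × In∃A 𝟘
    × In∃A 𝟙
theorem1 A =
  (In∀A⇒In∃A , In∃A⇒In∀A) , In∃A-∨ , In∃A-∧ , In∃A-* , In∃A-⇒ , In∃A-𝟘 , In∃A-𝟙
  where open EBLProperties A
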